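{- Let $T_1$ and $T_2$ be switching equivalent tournaments on the same vertex set $V$. Then $T_1$ is a strong CR tournament if and only if $T_2$ is a strong CR tournament.
   Context: A tournament is a digraph with exactly one arc between each pair of distinct vertices. For distinct vertices write $\theta_T(u,v)=1$ if $u\to v$, $-1$ otherwise. Skew-adjacency matrix $S_T$: entry $1$ if $v_i\to v_j$, $-1$ if $v_j\to v_i$, $0$ on the diagonal; $\det(T)=\det(S_T)$. For odd $k\ge1$, $\mathcal{D}_k$ is the set of tournaments all of whose induced subtournaments have determinant at most $k^2$; $\mathcal{D}_{ -1}=\emptyset$. The switch of $T$ w.r.t. $W\subseteq V(T)$ reverses all arcs between $W$ and $V(T)\setminus W$; $T$ and its switches are switching equivalent. A diamond is a 4-tournament consisting of a 3-cycle plus a vertex dominating all of it or dominated by all of it. A 1-transitive blowup of $T$ (vertices $v_1,\dots,v_n$) is obtained by replacing one vertex $v_i$ by two vertices $x\to y$, each of which has the same relation to every $v_j$ ($j\neq i$) as $v_i$ had. Two vertices $u_1,u_2$ of $T$ are covertices and revertices if $|V(T)|=2$; if $|V(T)|\ge3$ they are covertices if $\theta_T(u_1,v)=\theta_T(u_2,v)$ for all other $v$, revertices if $\theta_T(u_1,v)=-\theta_T(u_2,v)$ for all other $v$; CR-associated if covertices or revertices. For $u\notin V(T)=\{w_1,\dots,w_n\}$ and $\sigma=(r_1,\dots,r_n)\in\{\pm1\}^n$, $T(u,\sigma)$ extends $T$ by $u$ with $u\to w_i$ iff $r_i=1$; $u$ is a CR vertex for $T$ with $\sigma$ if $u$ is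 CR-associated in $T(u,\sigma)$ with some vertex of $T$, otherwise a non-CR vertex. Let $T\in\mathcal{D}_k\setminus\mathcal{D}_{k-2}$ for some odd $k$. $T$ is a CR tournament if $T$ is a 1-tournament, a 2-tournament or a diamond, or else for every $u\notin V(T)$ and every $\sigma$ with $u$ a non-CR vertex for $T$ with $\sigma$, $T(u,\sigma)\notin\mathcal{D}_k$. A strong CR tournament is a CR tournament all of whose 1-transitive blowups are CR tournaments. -}

module Defs where

open import Data.Bool using (Bool; true; false; not; _xor_)
open import Data.Bool.Properties using (not-involutive)
open import Data.Nat using (ℕ; zero; suc; _*_)
open import Data.Fin using (Fin; zero; suc; toℕ; punchIn; _≟_)
open import Data.Integer using (ℤ; +_; -_; _≤_) renaming (_+_ to _+ℤ_; _*_ to _*ℤ_)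
open import Data.Product using (Σ; ∃; _×_; _,_)
open import Data.Sum using (_⊎_)
open import Data.Empty using (⊥-elim)
open import Relation.Binary.PropositionalEquality using (_≡_; _≢_; refl; sym; cong)
open import Relation.Nullary using (¬_; yes; no)
open import Function.Definitions using (Injective)

-- Tournaments on the vertex set Fin n.
-- beats i j = true  means  i → j.  The diagonal value is irrelevant.

record Tournament (n : ℕ) : Set where
  field
    beats   : Fin n → Fin n → Bool
    antisym : ∀ i j → i ≢ j → beats i j ≡ not (beats j i)
open Tournament public

θ : ∀ {n} → Tournament n → Fin n → Fin n → ℤ
θ T i j with beats T i j
... | true  = + 1
... | false = - (+ 1)

S : ∀ {n} → Tournament n → Fin n → Fin n → ℤ
S T i j with i ≟ j
... | yes _ = + 0
... | no  _ = θ T i j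

sumFin : ∀ {n} → (Fin n → ℤ) → ℤ
sumFin {zero}  f = + 0
sumFin {suc n} f = f zero +ℤ sumFin (λ i → f (suc i))

sgn : ℕ → ℤ
sgn zero          = + 1
sgn (suc zero)    = - (+ 1)
sgn (suc (suc k)) = sgn k

det : ∀ {n} → (Fin n → Fin n → ℤ) → ℤ
det {zero}  M = + 1
det {suc n} M = sumFin (λ j → sgn (toℕ j) *ℤ (M zero j *ℤ det (λ a b → M (suc a) (punchIn j b))))

detT : ∀ {n} → Tournament n → ℤ
detT T = det (S T)

induced : ∀ {m n} → Tournament n → (f : Fin m → Fin n) → Injective _≡_ _≡_ f → Tournament m
induced T f inj = record
  { beats   = λ a b → beats T (f a) (f b)
  ; antisym = λ a b ne → antisym T (f a) (f b) (λ e → ne (inj e)) }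

-- T ∈ D_k with k = 2j+1 : every induced subtournament has determinant ≤ k²
InD : ∀ {n} → ℕ → Tournament n → Set
InD {n} j T = ∀ m (f : Fin m → Fin n) (inj : Injective _≡_ _≡_ f) →
  detT (induced T f inj) ≤ + ((suc (2 * j)) * (suc (2 * j)))

-- T ∈ D_k \ D_{k-2} with k = 2j+1  (D_{-1} = ∅)
Layer : ∀ {n} → ℕ → Tournament n → Set
Layer zero    T = InD zero T
Layer (suc j) T = InD (suc j) T × ¬ InD j T

switch : ∀ {n} → (Fin n → Bool) → Tournament n → Tournament n
switch {n} W T = record { beats = b ; antisym = a }
  where
  b : Fin n → Fin n → Bool
  b i j with W i xor W j
  ... | true  = not (beats T i j)
  ... | false = beats T i j
  a : ∀ i j → i ≢ j → b i j ≡ not (b j i)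
  a i j ne with W i | W j
  ... | true  | true  = antisym T i j ne
  ... | true  | false = cong not (antisym T i j ne)
  ... | false | true  = cong not (antisym T i j ne)
  ... | false | false = antisym T i j ne

SwitchEquiv : ∀ {n} → Tournament n → Tournament n → Set
SwitchEquiv {n} T₁ T₂ = ∃ λ (W : Fin n → Bool) →
  ∀ i j → i ≢ j → beats T₂ i j ≡ beats (switch W T₁) i j

cone : ∀ {n} → Tournament n → (Fin n → Bool) → Tournament (suc n)
cone {n} T ρ = record { beats = b ; antisym = a }
  where
  b : Fin (suc n) → Fin (suc n) → Bool
  b zero    zero    = false
  b zero    (suc j) = ρ j
  b (suc i) zero    = not (ρ i)
  b (suc i) (suc j) = beats T i j
  a : ∀ i j → i ≢ j → b i j ≡ not (b j i)
  a zero    zero    ne = ⊥-elim (ne refl)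
  a zero    (suc j) _  = sym (not-involutive (ρ j))
  a (suc i) zero    _  = refl
  a (suc i) (suc j) ne = antisym T i j (λ e → ne (cong suc e))

-- T(u,σ): u is vertex zero, w_i is suc i; u → w_i iff σ i = true (r_i = 1)
extend : ∀ {n} → Tournament n → (Fin n → Bool) → Tournament (suc n)
extend = cone

-- 1-transitive blowup at v_i: x = zero, y = suc i, x → y,
-- x and y both relate to every other v_j as v_i did.
blowRel : ∀ {n} → Tournament n → Fin n → Fin n → Bool
blowRel T i j with j ≟ i
... | yes _ = true
... | no  _ = beats T i j

blowup : ∀ {n} → Tournament n → Fin n → Tournament (suc n)
blowup T i = cone T (blowRel T i)

Covertices : ∀ {m} → Tournament m → Fin m → Fin m → Set
Covertices T u₁ u₂ = ∀ v → v ≢ u₁ → v ≢ u₂ → θ T u₁ v ≡ θ T u₂ v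

Revertices : ∀ {m} → Tournament m → Fin m → Fin m → Set
Revertices T u₁ u₂ = ∀ v → v ≢ u₁ → v ≢ u₂ → θ T u₁ v ≡ - θ T u₂ v

CRAssociated : ∀ {m} → Tournament m → Fin m → Fin m → Set
CRAssociated {m} T u₁ u₂ =
  u₁ ≢ u₂ × (m ≡ 2 ⊎ (Covertices T u₁ u₂ ⊎ Revertices T u₁ u₂))

CRVertex : ∀ {n} → Tournament n → (Fin n → Bool) → Set
CRVertex {n} T σ = ∃ λ (i : Fin n) → CRAssociated (extend T σ) zero (suc i)

_⟶_within_ : ∀ {n} → Fin n → Fin n → Tournament n → Set
x ⟶ y within T = beats T x y ≡ true

IsDiamond : ∀ {n} → Tournament n → Set
IsDiamond {n} T = n ≡ 4 × Σ (Fin n) λ a → Σ (Fin n) λ b → Σ (Fin n) λ c → Σ (Fin n) λ d →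
  (a ≢ b × a ≢ c × a ≢ d × b ≢ c × b ≢ d × c ≢ d) ×
  (a ⟶ b within T × b ⟶ c within T × c ⟶ a within T) ×
  ((d ⟶ a within T × d ⟶ b within T × d ⟶ c within T) ⊎
   (a ⟶ d within T × b ⟶ d within T × c ⟶ d within T))

CR : ∀ {n} → Tournament n → Set
CR {n} T = Σ ℕ λ j → Layer j T ×
  (n ≡ 1 ⊎ n ≡ 2 ⊎ IsDiamond T ⊎
   (∀ (σ : Fin n → Bool) → ¬ CRVertex T σ → ¬ InD j (extend T σ)))

StrongCR : ∀ {n} → Tournament n → Set
StrongCR {n} T = CR T × (∀ (i : Fin n) → CR (blowup T i))

{-# OPTIONS --safe #-}
-- Switching with respect to W replaces the skew-adjacency matrix S by D S D, where D is the diagonal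
-- matrix with entry -1 at the vertices of W and 1 elsewhere. Hence it preserves the determinant of
-- every induced subtournament, and so the layer D_k \ D_{k-2} containing a tournament. It multiplies
-- θ(u₁,v) and θ(u₂,v) by ε(u₁)ε(v) and ε(u₂)ε(v), so CR-associated pairs stay CR-associated
-- (covertices may become revertices and vice versa), and it maps diamonds to diamonds. Finally,
-- switching T(u,σ) by W gives the extension of the switched T by W xor σ, and switching a blowup of T
-- by W, with the new vertex on the side of the vertex it copies, gives the blowup of the switched T.
-- So every clause in the definition of a strong CR tournament is switching invariant.
module Submission where

open import Defs
open import Data.Nat using (ℕ)
open import Function.Bundles using (_⇔_)

open import Data.Bool using (Bool; true; false; not; _xor_)
open import Data.Bool.Properties
  using (not-involutive; xor-assoc; xor-comm; xor-same; xor-inverseʳ; not-distribʳ-xor)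
open import Data.Empty using (⊥-elim)
open import Data.Fin using (Fin; zero; suc; toℕ; punchIn; _≟_)
open import Data.Integer using (ℤ; +_; -_; _+_; _*_; _≤_; 1ℤ)
open import Data.Integer.Properties
  using (*-identityˡ; *-zeroʳ; -1*i≡-i; *-1-commutativeMonoid; +-*-semiring)
open import Data.Integer.Tactic.RingSolver using (solve-∀)
open import Data.Nat using (zero; suc)
open import Data.Product using (Σ; ∃; _×_; _,_)
open import Data.Sum using (_⊎_; inj₁; inj₂)
import Data.Sum as Sum
open import Data.Vec.Functional using (_∷_; removeAt)
open import Function using (_∘_; _$_; mk⇔; Equivalence)
open import Function.Definitions using (Injective)
open import Relation.Binary.PropositionalEquality
open import Relation.Nullary using (¬_; yes; no)

open import Algebra.Properties.CommutativeMonoid.Sum *-1-commutativeMonoid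
  using ()
  renaming (sum to product; sum-cong-≗ to product-cong-≗; sum-remove to product-remove;
            ∑-distrib-+ to product-distrib-*; sum-replicate-zero to product-replicate-one)
open import Algebra.Properties.Semiring.Sum +-*-semiring using (sum; sum-cong-≗; *-distribˡ-sum)

open ≡-Reasoning

sumFin≡sum : ∀ {n} (f : Fin n → ℤ) → sumFin f ≡ sum f
sumFin≡sum {zero}  f = refl
sumFin≡sum {suc n} f = cong (λ s → f zero + s) (sumFin≡sum (f ∘ suc))

sumFin-cong : ∀ {n} {f g : Fin n → ℤ} → f ≗ g → sumFin f ≡ sumFin g
sumFin-cong {f = f} {g} f≗g = begin
  sumFin f ≡⟨ sumFin≡sum f ⟩
  sum f    ≡⟨ sum-cong-≗ f≗g ⟩
  sum g    ≡⟨ sumFin≡sum g ⟨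
  sumFin g ∎

sumFin-*ˡ : ∀ {n} c (f : Fin n → ℤ) → sumFin (λ i → c * f i) ≡ c * sumFin f
sumFin-*ˡ c f = begin
  sumFin (λ i → c * f i) ≡⟨ sumFin≡sum (λ i → c * f i) ⟩
  sum (λ i → c * f i)    ≡⟨ *-distribˡ-sum c f ⟨
  c * sum f              ≡⟨ cong (c *_) (sumFin≡sum f) ⟨
  c * sumFin f           ∎

minor : ∀ {n} → (Fin (suc n) → Fin (suc n) → ℤ) → Fin (suc n) → Fin n → Fin n → ℤ
minor M j a b = M (suc a) (punchIn j b)

det-cong : ∀ {n} {M N : Fin n → Fin n → ℤ} → (∀ i j → M i j ≡ N i j) → det M ≡ det N
det-cong {zero}  _   = refl
det-cong {suc n} M≗N = sumFin-cong λ j →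
  cong₂ (λ x y → sgn (toℕ j) * (x * y)) (M≗N zero j) (det-cong λ a b → M≗N (suc a) (punchIn j b))

det-scale : ∀ {n} (e d : Fin n → ℤ) (M : Fin n → Fin n → ℤ) →
  det (λ i j → e i * (M i j * d j)) ≡ (product e * product d) * det M
det-scale {zero}  e d M = refl
det-scale {suc n} e d M =
  trans (sumFin-cong expand)
        (sumFin-*ˡ (product e * product d) (λ j → sgn (toℕ j) * (M zero j * det (minor M j))))
  where
  rearrange : ∀ s e₀ m dⱼ pe pd dm →
    s * ((e₀ * (m * dⱼ)) * ((pe * pd) * dm)) ≡ ((e₀ * pe) * (dⱼ * pd)) * (s * (m * dm))
  rearrange = solve-∀

  expand : ∀ j →
    sgn (toℕ j) * ((e zero * (M zero j * d j)) * det (minor (λ a b → e a * (M a b * d b)) j)) ≡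
    (product e * product d) * (sgn (toℕ j) * (M zero j * det (minor M j)))
  expand j = begin
    s * ((e zero * (m * d j)) * det (minor (λ a b → e a * (M a b * d b)) j))
      ≡⟨ cong (λ x → s * ((e zero * (m * d j)) * x)) (det-scale (e ∘ suc) (removeAt d j) (minor M j)) ⟩
    s * ((e zero * (m * d j)) * ((product (e ∘ suc) * product (removeAt d j)) * det (minor M j)))
      ≡⟨ rearrange s (e zero) m (d j) (product (e ∘ suc)) (product (removeAt d j)) (det (minor M j)) ⟩
    (product e * (d j * product (removeAt d j))) * (s * (m * det (minor M j)))
      ≡⟨ cong (λ x → (product e * x) * (s * (m * det (minor M j)))) (product-remove d) ⟨
    (product e * product d) * (s * (m * det (minor M j)))
      ∎
    where
    s m : ℤ
    s = sgn (toℕ j)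
    m = M zero j

product-≡1 : ∀ {n} {f : Fin n → ℤ} → (∀ i → f i ≡ 1ℤ) → product f ≡ 1ℤ
product-≡1 {n} f≡1 = trans (product-cong-≗ f≡1) (product-replicate-one n)

ε : Bool → ℤ
ε false = + 1
ε true  = - (+ 1)

ε-xor : ∀ x y → ε (x xor y) ≡ ε x * ε y
ε-xor false y     = sym (*-identityˡ (ε y))
ε-xor true  false = refl
ε-xor true  true  = refl

ε-square : ∀ x → ε x * ε x ≡ 1ℤ
ε-square false = refl
ε-square true  = refl

θ≡ε∘not : ∀ {n} (T : Tournament n) i j → θ T i j ≡ ε (not (beats T i j))
θ≡ε∘not T i j with beats T i j
... | true  = refl
... | false = refl

record Switched {n} (W : Fin n → Bool) (T U : Tournament n) : Set where
  constructor switched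
  field
    beats-switched : ∀ i j → i ≢ j → beats U i j ≡ (W i xor W j) xor beats T i j

open Switched

switchEquiv⇒switched : ∀ {n} {T U : Tournament n} → SwitchEquiv T U → ∃ λ W → Switched W T U
switchEquiv⇒switched {T = T} (W , U≈switch) =
  W , switched λ i j i≢j → trans (U≈switch i j i≢j) (switch-beats i j)
  where
  switch-beats : ∀ i j → beats (switch W T) i j ≡ (W i xor W j) xor beats T i j
  switch-beats i j with W i xor W j
  ... | true  = refl
  ... | false = refl

module _ {n} {W : Fin n → Bool} {T U : Tournament n} (T⇝U : Switched W T U) where

  switched-sym : Switched W U T
  switched-sym .beats-switched i j i≢j = begin
    beats T i j                    ≡⟨ cong (_xor beats T i j) (xor-same c) ⟨
    (c xor c) xor beats T i j      ≡⟨ xor-assoc c c (beats T i j) ⟩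
    c xor (c xor beats T i j)      ≡⟨ cong (c xor_) (beats-switched T⇝U i j i≢j) ⟨
    c xor beats U i j              ∎
    where
    c : Bool
    c = W i xor W j

  switched-complement : Switched (not ∘ W) T U
  switched-complement .beats-switched i j i≢j =
    trans (beats-switched T⇝U i j i≢j) (cong (_xor beats T i j) (not-xor-not (W i) (W j)))
    where
    not-xor-not : ∀ x y → x xor y ≡ not x xor not y
    not-xor-not false y = sym (not-involutive y)
    not-xor-not true  y = refl

  θ-switched : ∀ {i j} → i ≢ j → θ U i j ≡ ε (W i) * (θ T i j * ε (W j))
  θ-switched {i} {j} i≢j = begin
    θ U i j                                  ≡⟨ θ≡ε∘not U i j ⟩
    ε (not (beats U i j))                    ≡⟨ cong (ε ∘ not) (beats-switched T⇝U i j i≢j) ⟩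
    ε (not ((W i xor W j) xor beats T i j))  ≡⟨ cong ε (not-distribʳ-xor (W i xor W j) (beats T i j)) ⟩
    ε ((W i xor W j) xor not (beats T i j))  ≡⟨ ε-xor (W i xor W j) (not (beats T i j)) ⟩
    ε (W i xor W j) * ε (not (beats T i j))  ≡⟨ cong₂ _*_ (ε-xor (W i) (W j)) (sym (θ≡ε∘not T i j)) ⟩
    (ε (W i) * ε (W j)) * θ T i j            ≡⟨ regroup (ε (W i)) (ε (W j)) (θ T i j) ⟩
    ε (W i) * (θ T i j * ε (W j))            ∎
    where
    regroup : ∀ x y t → (x * y) * t ≡ x * (t * y)
    regroup = solve-∀

  S-switched : ∀ i j → S U i j ≡ ε (W i) * (S T i j * ε (W j))
  S-switched i j with i ≟ j
  ... | yes _   = sym (*-zeroʳ (ε (W i)))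
  ... | no  i≢j = θ-switched i≢j

  detT-switched : detT U ≡ detT T
  detT-switched = begin
    det (S U)                                        ≡⟨ det-cong S-switched ⟩
    det (λ i j → ε (W i) * (S T i j * ε (W j)))      ≡⟨ det-scale (ε ∘ W) (ε ∘ W) (S T) ⟩
    (product (ε ∘ W) * product (ε ∘ W)) * det (S T)  ≡⟨ cong (_* det (S T)) product-square ⟩
    1ℤ * det (S T)                                   ≡⟨ *-identityˡ (det (S T)) ⟩
    det (S T)                                        ∎
    where
    product-square : product (ε ∘ W) * product (ε ∘ W) ≡ 1ℤ
    product-square = trans (sym (product-distrib-* (ε ∘ W) (ε ∘ W))) (product-≡1 (ε-square ∘ W))

induced-switched : ∀ {m n} {W : Fin n → Bool} {T U : Tournament n} → Switched W T U →
  (f : Fin m → Fin n) (inj : Injective _≡_ _≡_ f) → Switched (W ∘ f) (induced T f inj) (induced U f inj)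
induced-switched T⇝U f inj .beats-switched a b a≢b = beats-switched T⇝U (f a) (f b) (a≢b ∘ inj)

InD-switched : ∀ {n} {W : Fin n → Bool} {T U : Tournament n} j → Switched W T U → InD j T → InD j U
InD-switched j T⇝U T∈D m f inj =
  subst (_≤ _) (sym (detT-switched (induced-switched T⇝U f inj))) (T∈D m f inj)

Layer-switched : ∀ {n} {W : Fin n → Bool} {T U : Tournament n} j → Switched W T U → Layer j T → Layer j U
Layer-switched zero    T⇝U T∈D          = InD-switched zero T⇝U T∈D
Layer-switched (suc j) T⇝U (T∈D , T∉D′) =
  InD-switched (suc j) T⇝U T∈D , T∉D′ ∘ InD-switched j (switched-sym T⇝U)

cone-switched : ∀ {n} {W : Fin n → Bool} {T U : Tournament n} → Switched W T U →
  ∀ {b ρ ρ′} → (∀ j → ρ′ j ≡ (b xor W j) xor ρ j) → Switched (b ∷ W) (cone T ρ) (cone U ρ′)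
cone-switched T⇝U ρ′≡ .beats-switched zero    zero    0≢0 = ⊥-elim (0≢0 refl)
cone-switched T⇝U ρ′≡ .beats-switched zero    (suc j) _   = ρ′≡ j
cone-switched {W = W} T⇝U {b} {ρ} {ρ′} ρ′≡ .beats-switched (suc i) zero _ = begin
  not (ρ′ i)                    ≡⟨ cong not (ρ′≡ i) ⟩
  not ((b xor W i) xor ρ i)     ≡⟨ not-distribʳ-xor (b xor W i) (ρ i) ⟩
  (b xor W i) xor not (ρ i)     ≡⟨ cong (_xor not (ρ i)) (xor-comm b (W i)) ⟩
  (W i xor b) xor not (ρ i)     ∎
cone-switched T⇝U ρ′≡ .beats-switched (suc i) (suc j) i≢j = beats-switched T⇝U i j (i≢j ∘ cong suc)

extend-switched : ∀ {n} {W : Fin n → Bool} {T U : Tournament n} → Switched W T U →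
  ∀ σ → Switched (false ∷ W) (extend T σ) (extend U (λ i → W i xor σ i))
extend-switched T⇝U σ = cone-switched T⇝U (λ _ → refl)

blowup-switched : ∀ {n} {W : Fin n → Bool} {T U : Tournament n} → Switched W T U →
  ∀ i → Switched (W i ∷ W) (blowup T i) (blowup U i)
blowup-switched {W = W} {T} {U} T⇝U i = cone-switched T⇝U blowRel-switched
  where
  blowRel-switched : ∀ j → blowRel U i j ≡ (W i xor W j) xor blowRel T i j
  blowRel-switched j with j ≟ i
  ... | yes refl = sym (cong (_xor true) (xor-same (W j)))
  ... | no  j≢i  = beats-switched T⇝U i j (j≢i ∘ sym)

Twins : ∀ {m} → Tournament m → Bool → Fin m → Fin m → Set
Twins T b u₁ u₂ = ∀ v → v ≢ u₁ → v ≢ u₂ → θ T u₁ v ≡ ε b * θ T u₂ v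

co-or-revertices⇔twins : ∀ {m} (T : Tournament m) {u₁ u₂} →
  (Covertices T u₁ u₂ ⊎ Revertices T u₁ u₂) ⇔ (∃ λ b → Twins T b u₁ u₂)
co-or-revertices⇔twins T {u₁} {u₂} = mk⇔ to from
  where
  to : Covertices T u₁ u₂ ⊎ Revertices T u₁ u₂ → ∃ λ b → Twins T b u₁ u₂
  to (inj₁ co) = false , λ v p q → trans (co v p q) (sym (*-identityˡ (θ T u₂ v)))
  to (inj₂ re) = true  , λ v p q → trans (re v p q) (sym (-1*i≡-i (θ T u₂ v)))
  from : (∃ λ b → Twins T b u₁ u₂) → Covertices T u₁ u₂ ⊎ Revertices T u₁ u₂
  from (false , tw) = inj₁ λ v p q → trans (tw v p q) (*-identityˡ (θ T u₂ v))
  from (true  , tw) = inj₂ λ v p q → trans (tw v p q) (-1*i≡-i (θ T u₂ v))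

twins-switched : ∀ {n} {W : Fin n → Bool} {T U : Tournament n} → Switched W T U →
  ∀ {b u₁ u₂} → Twins T b u₁ u₂ → Twins U ((W u₁ xor b) xor W u₂) u₁ u₂
twins-switched {W = W} {T} {U} T⇝U {b} {u₁} {u₂} tw v v≢u₁ v≢u₂ = begin
  θ U u₁ v                                  ≡⟨ θ-switched T⇝U (v≢u₁ ∘ sym) ⟩
  ε₁ * (θ T u₁ v * εᵥ)                      ≡⟨ cong (λ t → ε₁ * (t * εᵥ)) (tw v v≢u₁ v≢u₂) ⟩
  ε₁ * ((ε b * θ T u₂ v) * εᵥ)              ≡⟨ regroup ε₁ (ε b) ε₂ (θ T u₂ v) εᵥ (ε-square (W u₂)) ⟩
  ((ε₁ * ε b) * ε₂) * (ε₂ * (θ T u₂ v * εᵥ)) ≡⟨ cong₂ _*_ sign (θ-switched T⇝U (v≢u₂ ∘ sym)) ⟨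
  ε ((W u₁ xor b) xor W u₂) * θ U u₂ v      ∎
  where
  ε₁ ε₂ εᵥ : ℤ
  ε₁ = ε (W u₁)
  ε₂ = ε (W u₂)
  εᵥ = ε (W v)
  sign : ε ((W u₁ xor b) xor W u₂) ≡ (ε₁ * ε b) * ε₂
  sign = trans (ε-xor (W u₁ xor b) (W u₂)) (cong (_* ε₂) (ε-xor (W u₁) b))
  regroup : ∀ x c y t z → y * y ≡ 1ℤ → x * ((c * t) * z) ≡ ((x * c) * y) * (y * (t * z))
  regroup x c y t z y²≡1 = begin
    x * ((c * t) * z)               ≡⟨ *-identityˡ (x * ((c * t) * z)) ⟨
    1ℤ * (x * ((c * t) * z))        ≡⟨ cong (λ u → u * (x * ((c * t) * z))) y²≡1 ⟨
    (y * y) * (x * ((c * t) * z))   ≡⟨ rearrange x c y t z ⟩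
    ((x * c) * y) * (y * (t * z))   ∎
    where
    rearrange : ∀ x c y t z → (y * y) * (x * ((c * t) * z)) ≡ ((x * c) * y) * (y * (t * z))
    rearrange = solve-∀

CRAssociated-switched : ∀ {n} {W : Fin n → Bool} {T U : Tournament n} → Switched W T U →
  ∀ {u₁ u₂} → CRAssociated T u₁ u₂ → CRAssociated U u₁ u₂
CRAssociated-switched T⇝U (u₁≢u₂ , inj₁ n≡2) = u₁≢u₂ , inj₁ n≡2
CRAssociated-switched {W = W} {T} {U} T⇝U {u₁} {u₂} (u₁≢u₂ , inj₂ co-or-re)
  with Equivalence.to (co-or-revertices⇔twins T) co-or-re
... | b , tw = u₁≢u₂ , inj₂ (Equivalence.from (co-or-revertices⇔twins U)
                              ((W u₁ xor b) xor W u₂ , twins-switched T⇝U {b} {u₁} {u₂} tw))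

Cycle : ∀ {n} → Tournament n → Fin n → Fin n → Fin n → Set
Cycle T a b c = a ⟶ b within T × b ⟶ c within T × c ⟶ a within T

Apex : ∀ {n} → Tournament n → Fin n → Fin n → Fin n → Fin n → Set
Apex T d a b c =
  (d ⟶ a within T × d ⟶ b within T × d ⟶ c within T) ⊎
  (a ⟶ d within T × b ⟶ d within T × c ⟶ d within T)

record DiamondOn {n} (T : Tournament n) (a b c d : Fin n) : Set where
  constructor diamondOn
  field
    distinct : a ≢ b × a ≢ c × a ≢ d × b ≢ c × b ≢ d × c ≢ d
    cycle    : Cycle T a b c
    apex     : Apex T d a b c

Diamond : ∀ {n} → Tournament n → Set
Diamond {n} T = Σ (Fin n) λ a → Σ (Fin n) λ b → Σ (Fin n) λ c → Σ (Fin n) λ d → DiamondOn T a b c d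

rotate : ∀ {n} {T : Tournament n} {a b c d} → DiamondOn T a b c d → DiamondOn T b c a d
rotate (diamondOn (a≢b , a≢c , a≢d , b≢c , b≢d , c≢d) (ab , bc , ca) apex) =
  diamondOn (b≢c , ≢-sym a≢b , b≢d , ≢-sym a≢c , c≢d , a≢d) (bc , ca , ab) $
    Sum.map (λ (da , db , dc) → db , dc , da) (λ (ad , bd , cd) → bd , cd , ad) apex

module _ {n} {W : Fin n → Bool} {T U : Tournament n} (T⇝U : Switched W T U) where

  arc-kept : ∀ {x y s} → W x ≡ s → W y ≡ s → x ≢ y → x ⟶ y within T → x ⟶ y within U
  arc-kept {x} {y} {s} wx wy x≢y xy =
    trans (beats-switched T⇝U x y x≢y) (cong₂ _xor_ (trans (cong₂ _xor_ wx wy) (xor-same s)) xy)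

  arc-reversed : ∀ {x y s} → W x ≡ s → W y ≡ not s → x ≢ y → y ⟶ x within T → x ⟶ y within U
  arc-reversed {x} {y} {s} wx wy x≢y yx =
    trans (beats-switched T⇝U x y x≢y)
          (cong₂ _xor_ (trans (cong₂ _xor_ wx wy) (xor-inverseʳ s))
                       (trans (antisym T x y x≢y) (cong not yx)))

  diamond-switched-cycle-outside : ∀ {a b c d} → W a ≡ false → W b ≡ false → W c ≡ false →
    DiamondOn T a b c d → Diamond U
  diamond-switched-cycle-outside {a} {b} {c} {d} ea eb ec
    (diamondOn ne@(a≢b , a≢c , a≢d , b≢c , b≢d , c≢d) (ab , bc , ca) apex) =
    a , b , c , d ,
    diamondOn ne (arc-kept ea eb a≢b ab , arc-kept eb ec b≢c bc , arc-kept ec ea (≢-sym a≢c) ca)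
                 (apex′ apex)
    where
    apex′ : Apex T d a b c → Apex U d a b c
    apex′ t-apex with W d in ed | t-apex
    ... | false | inj₁ (da , db , dc) =
      inj₁ (arc-kept ed ea (≢-sym a≢d) da , arc-kept ed eb (≢-sym b≢d) db ,
            arc-kept ed ec (≢-sym c≢d) dc)
    ... | false | inj₂ (ad , bd , cd) =
      inj₂ (arc-kept ea ed a≢d ad , arc-kept eb ed b≢d bd , arc-kept ec ed c≢d cd)
    ... | true  | inj₁ (da , db , dc) =
      inj₂ (arc-reversed ea ed a≢d da , arc-reversed eb ed b≢d db , arc-reversed ec ed c≢d dc)
    ... | true  | inj₂ (ad , bd , cd) =
      inj₁ (arc-reversed ed ea (≢-sym a≢d) ad , arc-reversed ed eb (≢-sym b≢d) bd ,
            arc-reversed ed ec (≢-sym c≢d) cd)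

  -- In U, b → a → c and b → c, so d closes the 3-cycle a → d → b or d → a → c, according to the
  -- direction of the arc between a and d.
  diamond-switched-only-a : ∀ {a b c d} → W a ≡ true → W b ≡ false → W c ≡ false →
    DiamondOn T a b c d → Diamond U
  diamond-switched-only-a {a} {b} {c} {d} ea eb ec
    (diamondOn (a≢b , a≢c , a≢d , b≢c , b≢d , c≢d) (ab , bc , ca) apex) =
    from-apex apex
    where
    b≢a : b ≢ a
    b≢a = ≢-sym a≢b
    c≢b : c ≢ b
    c≢b = ≢-sym b≢c
    d≢a : d ≢ a
    d≢a = ≢-sym a≢d
    d≢b : d ≢ b
    d≢b = ≢-sym b≢d
    d≢c : d ≢ c
    d≢c = ≢-sym c≢d
    from-apex : Apex T d a b c → Diamond U
    from-apex t-apex with W d in ed | t-apex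
    ... | false | inj₁ (da , db , dc) = a , d , b , c , diamondOn (a≢d , a≢b , a≢c , d≢b , d≢c , b≢c)
      (arc-reversed ea ed a≢d da , arc-kept ed eb d≢b db , arc-reversed eb ea b≢a ab)
      (inj₂ (arc-reversed ea ec a≢c ca , arc-kept ed ec d≢c dc , arc-kept eb ec b≢c bc))
    ... | false | inj₂ (ad , bd , cd) = d , a , c , b , diamondOn (d≢a , d≢c , d≢b , a≢c , a≢b , c≢b)
      (arc-reversed ed ea d≢a ad , arc-reversed ea ec a≢c ca , arc-kept ec ed c≢d cd)
      (inj₁ (arc-kept eb ed b≢d bd , arc-reversed eb ea b≢a ab , arc-kept eb ec b≢c bc))
    ... | true  | inj₁ (da , db , dc) = d , a , c , b , diamondOn (d≢a , d≢c , d≢b , a≢c , a≢b , c≢b)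
      (arc-kept ed ea d≢a da , arc-reversed ea ec a≢c ca , arc-reversed ec ed c≢d dc)
      (inj₁ (arc-reversed eb ed b≢d db , arc-reversed eb ea b≢a ab , arc-kept eb ec b≢c bc))
    ... | true  | inj₂ (ad , bd , cd) = a , d , b , c , diamondOn (a≢d , a≢b , a≢c , d≢b , d≢c , b≢c)
      (arc-kept ea ed a≢d ad , arc-reversed ed eb d≢b bd , arc-reversed eb ea b≢a ab)
      (inj₂ (arc-reversed ea ec a≢c ca , arc-reversed ed ec d≢c cd , arc-kept eb ec b≢c bc))

diamond-switched-cycle-one-side : ∀ {n} {W : Fin n → Bool} {T U : Tournament n} → Switched W T U →
  ∀ {s a b c d} → W a ≡ s → W b ≡ s → W c ≡ s → DiamondOn T a b c d → Diamond U
diamond-switched-cycle-one-side T⇝U {s = false} = diamond-switched-cycle-outside T⇝U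
diamond-switched-cycle-one-side T⇝U {s = true}  ea eb ec =
  diamond-switched-cycle-outside (switched-complement T⇝U) (cong not ea) (cong not eb) (cong not ec)

diamond-switched-a-apart : ∀ {n} {W : Fin n → Bool} {T U : Tournament n} → Switched W T U →
  ∀ {s a b c d} → W a ≡ not s → W b ≡ s → W c ≡ s → DiamondOn T a b c d → Diamond U
diamond-switched-a-apart T⇝U {s = false} = diamond-switched-only-a T⇝U
diamond-switched-a-apart T⇝U {s = true}  ea eb ec =
  diamond-switched-only-a (switched-complement T⇝U) (cong not ea) (cong not eb) (cong not ec)

diamond-switched : ∀ {n} {W : Fin n → Bool} {T U : Tournament n} → Switched W T U →
  ∀ {a b c d} → DiamondOn T a b c d → Diamond U
diamond-switched {W = W} T⇝U {a} {b} {c} D with W a in ea | W b in eb | W c in ec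
... | false | false | false = diamond-switched-cycle-one-side T⇝U ea eb ec D
... | true  | true  | true  = diamond-switched-cycle-one-side T⇝U ea eb ec D
... | true  | false | false = diamond-switched-a-apart T⇝U ea eb ec D
... | false | true  | true  = diamond-switched-a-apart T⇝U ea eb ec D
... | false | true  | false = diamond-switched-a-apart T⇝U eb ec ea (rotate D)
... | true  | false | true  = diamond-switched-a-apart T⇝U eb ec ea (rotate D)
... | false | false | true  = diamond-switched-a-apart T⇝U ec ea eb (rotate (rotate D))
... | true  | true  | false = diamond-switched-a-apart T⇝U ec ea eb (rotate (rotate D))

IsDiamond-switched : ∀ {n} {W : Fin n → Bool} {T U : Tournament n} → Switched W T U →
  IsDiamond T → IsDiamond U
IsDiamond-switched T⇝U (n≡4 , a , b , c , d , ne , cyc , apex)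
  with diamond-switched T⇝U (diamondOn ne cyc apex)
... | a′ , b′ , c′ , d′ , diamondOn ne′ cyc′ apex′ = n≡4 , a′ , b′ , c′ , d′ , ne′ , cyc′ , apex′

nonCR-extensions-switched : ∀ {n} {W : Fin n → Bool} {T U : Tournament n} → Switched W T U → ∀ j →
  (∀ σ → ¬ CRVertex T σ → ¬ InD j (extend T σ)) → (∀ σ → ¬ CRVertex U σ → ¬ InD j (extend U σ))
nonCR-extensions-switched {W = W} {T} {U} T⇝U j T-closed σ σ-nonCR Uσ∈D =
  T-closed (λ i → W i xor σ i) (σ-nonCR ∘ CRVertex-transfer) (InD-switched j Uσ⇝Tσ Uσ∈D)
  where
  Uσ⇝Tσ : Switched (false ∷ W) (extend U σ) (extend T (λ i → W i xor σ i))
  Uσ⇝Tσ = extend-switched (switched-sym T⇝U) σ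
  CRVertex-transfer : CRVertex T (λ i → W i xor σ i) → CRVertex U σ
  CRVertex-transfer (i , cr) = i , CRAssociated-switched (switched-sym Uσ⇝Tσ) cr

CR-switched : ∀ {n} {W : Fin n → Bool} {T U : Tournament n} → Switched W T U → CR T → CR U
CR-switched T⇝U (j , layer , kind) =
  j , Layer-switched j T⇝U layer ,
  Sum.map₂ (Sum.map₂ (Sum.map (IsDiamond-switched T⇝U) (nonCR-extensions-switched T⇝U j))) kind

StrongCR-switched : ∀ {n} {W : Fin n → Bool} {T U : Tournament n} → Switched W T U →
  StrongCR T → StrongCR U
StrongCR-switched T⇝U (cr , blowups-cr) =
  CR-switched T⇝U cr , λ i → CR-switched (blowup-switched T⇝U i) (blowups-cr i)

theorem4p4 : ∀ {n : ℕ} (T₁ T₂ : Tournament n) → SwitchEquiv T₁ T₂ →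
    (StrongCR T₁ ⇔ StrongCR T₂)
theorem4p4 T₁ T₂ T₁≈T₂ with switchEquiv⇒switched T₁≈T₂
... | _ , T₁⇝T₂ = mk⇔ (StrongCR-switched T₁⇝T₂) (StrongCR-switched (switched-sym T₁⇝T₂))
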